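{- For $n\ge0$ let $a_n$ be the number of permutations $\pi$ of $\{1,\dots,n\}$ with $\#132(\pi)=0$ and $\#123(\pi)=4$. Then $$\sum_{n\ge0}a_nz^n=\frac{ -z^4(z^5-3z^4+11z^3-13z^2+6z-1)}{(1-2z)^5}.$$
   Context: For a permutation $\pi=\pi_1\cdots\pi_n$, $\#123(\pi)$ is the number of triples $i_1<i_2<i_3$ with $\pi_{i_1}<\pi_{i_2}<\pi_{i_3}$, and $\#132(\pi)$ is the number of triples $i_1<i_2<i_3$ with $\pi_{i_1}<\pi_{i_3}<\pi_{i_2}$. -}

module Defs where

open import Data.Nat using (ℕ; zero; suc; _<ᵇ_)
open import Data.Bool using (Bool; true; false; _∧_; not; if_then_else_)
open import Data.Fin using (Fin; toℕ)
open import Data.Fin.Properties using (_≟_)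
open import Data.Vec using (Vec; []; _∷_; lookup)
open import Data.List using (List; []; _∷_; length; filter; map; concatMap; allFin)
open import Data.Bool.ListAction using (and)
open import Data.Nat.ListAction using (sum)
open import Data.Integer using (ℤ; +_; -_; _+_; _*_; _-_)
open import Relation.Nullary.Decidable using (⌊_⌋)

allVecs : (n m : ℕ) → List (Vec (Fin m) n)
allVecs zero    m = [] ∷ []
allVecs (suc n) m = concatMap (λ x → map (x ∷_) (allVecs n m)) (allFin m)

-- A vector v : Vec (Fin n) n (one-line notation π₁⋯πₙ, values shifted to 0..n-1)
-- is a permutation iff its entries are pairwise distinct (injective).
isPerm : ∀ {n} → Vec (Fin n) n → Bool
isPerm {n} v =
  and (concatMap (λ i → map (λ j → (not (toℕ i <ᵇ toℕ j)) ∨' not ⌊ lookup v i ≟ lookup v j ⌋) (allFin n)) (allFin n))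
  where
  _∨'_ : Bool → Bool → Bool
  true  ∨' _ = true
  false ∨' b = b

perms : (n : ℕ) → List (Vec (Fin n) n)
perms n = filter (λ v → Data.Bool._≟_ (isPerm v) true) (allVecs n n)
  where import Data.Bool

countTriples : ∀ {n} → (ℕ → ℕ → ℕ → Bool) → Vec (Fin n) n → ℕ
countTriples {n} P v =
  sum (concatMap (λ i → concatMap (λ j → map (λ k →
         if (toℕ i <ᵇ toℕ j) ∧ (toℕ j <ᵇ toℕ k)
              ∧ P (toℕ (lookup v i)) (toℕ (lookup v j)) (toℕ (lookup v k))
         then 1 else 0) (allFin n)) (allFin n)) (allFin n))

#123 : ∀ {n} → Vec (Fin n) n → ℕ
#123 = countTriples (λ a b c → (a <ᵇ b) ∧ (b <ᵇ c))

#132 : ∀ {n} → Vec (Fin n) n → ℕ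
#132 = countTriples (λ a b c → (a <ᵇ c) ∧ (c <ᵇ b))

isZero isFour : ℕ → Bool
isZero 0 = true
isZero _ = false
isFour 4 = true
isFour _ = false

a : ℕ → ℕ
a n = length (filter (λ π → Data.Bool._≟_ (isZero (#132 π) ∧ isFour (#123 π)) true) (perms n))
  where import Data.Bool

-- Formal power series over ℤ (as coefficient sequences) and polynomials
-- (as coefficient lists, lowest degree first).

Poly : Set
Poly = List ℤ

pcoeff : Poly → ℕ → ℤ
pcoeff []       _       = + 0
pcoeff (c ∷ cs) zero    = c
pcoeff (c ∷ cs) (suc k) = pcoeff cs k

pscale : ℤ → Poly → Poly
pscale c = map (c *_)

padd : Poly → Poly → Poly
padd []       q        = q
padd p        []       = p
padd (x ∷ p) (y ∷ q)   = (x + y) ∷ padd p q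

pmul : Poly → Poly → Poly
pmul []       q = []
pmul (c ∷ p)  q = padd (pscale c q) (+ 0 ∷ pmul p q)

ppow : Poly → ℕ → Poly
ppow p zero    = + 1 ∷ []
ppow p (suc k) = pmul p (ppow p k)

-- coefficient of z^n in (Σ f_k z^k) · q(z)
seriesTimesPoly : (ℕ → ℤ) → Poly → ℕ → ℤ
seriesTimesPoly f []       n       = + 0
seriesTimesPoly f (c ∷ cs) zero    = c * f zero
seriesTimesPoly f (c ∷ cs) (suc n) = c * f (suc n) + seriesTimesPoly f cs n

denom : Poly
denom = ppow (+ 1 ∷ - (+ 2) ∷ []) 5

numer : Poly
numer = pmul (+ 0 ∷ + 0 ∷ + 0 ∷ + 0 ∷ - (+ 1) ∷ [])
             (- (+ 1) ∷ + 6 ∷ - (+ 13) ∷ + 11 ∷ - (+ 3) ∷ + 1 ∷ [])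

A : ℕ → ℤ
A n = + (a n)

-- In a 132-avoiding permutation the letters larger than the first letter x appear in
-- increasing order, so x starts exactly C(m,2) copies of 123, m being the number of larger
-- letters, and what follows x standardises to a 132-avoider whose letters above x increase.
-- Counting 132-avoiders of length n with j copies of 123 whose k largest letters increase
-- therefore gives, for j ≤ 4, a recurrence in n in which only m ≤ 3 occurs (C(4,2) > 4):
-- a fixed linear map on 4 × 5 tables.  Multiplying the sequence of tables by (1 - 2z)^5
-- gives a sequence obeying the same linear recurrence; it vanishes at n = 11 by
-- computation, hence for all n ≥ 11, and the coefficients below 11 are computed directly.
module Submission where

open import Defs
open import Agda.Builtin.Int using (pos)
open import Data.Bool using (Bool; true; false; not; _∧_; if_then_else_)
import Data.Bool as Bool
open import Data.Bool.ListAction using (and)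
open import Data.Bool.Properties using (if-float; ∧-zeroʳ; ∧-assoc; ∧-conicalˡ; ∧-conicalʳ; T-≡)
open import Data.Fin using (Fin; zero; suc; toℕ; punchIn; fromℕ<)
import Data.Fin.Permutation as Permutation
open import Data.Fin.Properties using (_≟_; all?; toℕ<n; toℕ≤pred[n]; toℕ-fromℕ<; opposite-prop)
open import Data.Integer as ℤ using (ℤ; 0ℤ; 1ℤ)
import Data.Integer.Properties as ℤ
open import Data.List as List using (List; []; _∷_; _++_; map; concatMap; allFin; filter; length)
open import Data.List.Properties using (map-tabulate; map-concatMap; map-∘; map-cong; concatMap-cong)
open import Data.List.Relation.Unary.All as All using (All; []; _∷_)
open import Data.List.Relation.Unary.All.Properties using (tabulate⁺)
open import Data.Nat
  using ( ℕ; zero; suc; _+_; _∸_; _≤_; _<_; _≤′_; z≤n; s≤s; z<s; s≤s⁻¹; ≤′-refl; ≤′-step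
        ; _<ᵇ_; _≤ᵇ_; _≡ᵇ_)
open import Data.Nat.Combinatorics using (_C_; nC1≡n; nCk+nC[k+1]≡[n+1]C[k+1])
import Data.Nat.ListAction as ℕList
open import Data.Nat.ListAction.Properties using (sum-++)
open import Data.Nat.Properties
  using ( +-0-commutativeMonoid; +-assoc; +-mono-≤; +-∸-assoc; 0∸n≡0; m∸n≤m; m∸[m∸n]≡n
        ; ≤-refl; ≤-reflexive; ≤-trans; ≤-<-trans; ≤-<-connex; <-cmp; _<?_; ≮⇒≥
        ; ≤ᵇ⇒≤; ≡ᵇ⇒≡
        ; m≤n⇒m≤1+n; m≤n⇒m<n∨m≡n; n≤1+n; n<1+n; m≤m+n; m≤n+m; ≤⇒≤′; ≤′⇒≤)
open import Data.Product using (Σ; _×_; _,_; proj₁; proj₂)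
open import Data.Sum using (inj₁; inj₂)
open import Data.Vec using (Vec; []; _∷_; lookup)
open import Function using (_∘_)
open import Function.Bundles using (Equivalence)
open import Relation.Binary.Definitions using (tri<; tri≈; tri>)
open import Relation.Binary.PropositionalEquality
open import Relation.Nullary.Decidable using (⌊_⌋; yes; no; toWitness)
open import Relation.Nullary.Negation using (contradiction)

open import Algebra.Properties.CommutativeMonoid.Sum +-0-commutativeMonoid
  using (sum-syntax; sum-cong-≗; sum-replicate-zero; sum-remove; ∑-permute)
import Algebra.Properties.Semiring.Sum ℤ.+-*-semiring as ℤΣ

count : {X : Set} → (X → Bool) → List X → ℕ
count p []       = 0
count p (x ∷ xs) = (if p x then 1 else 0) + count p xs

pairs : (ℕ → ℕ → Bool) → List ℕ → ℕ
pairs R []      = 0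
pairs R (x ∷ l) = count (R x) l + pairs R l

triples : (ℕ → ℕ → ℕ → Bool) → List ℕ → ℕ
triples P []      = 0
triples P (x ∷ l) = pairs (P x) l + triples P l

pattern123 pattern132 : ℕ → ℕ → ℕ → Bool
pattern123 x y z = (x <ᵇ y) ∧ (y <ᵇ z)
pattern132 x y z = (x <ᵇ z) ∧ (z <ᵇ y)

distinct : List ℕ → Bool
distinct l = isZero (pairs _≡ᵇ_ l)

absent : ℕ → List ℕ → Bool
absent x l = isZero (count (x ≡ᵇ_) l)

inversionFrom : ℕ → ℕ → ℕ → Bool
inversionFrom t y z = (t ≤ᵇ z) ∧ (z <ᵇ y)

increasingFrom : ℕ → List ℕ → Bool
increasingFrom t l = isZero (pairs (inversionFrom t) l)

avoids132 : List ℕ → Bool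
avoids132 l = isZero (triples pattern132 l)

count-++ : ∀ {X : Set} (p : X → Bool) xs ys → count p (xs ++ ys) ≡ count p xs + count p ys
count-++ p []       ys = refl
count-++ p (x ∷ xs) ys =
  trans (cong ((if p x then 1 else 0) +_) (count-++ p xs ys)) (sym (+-assoc (if p x then 1 else 0) _ _))

count-concatMap : ∀ {X Y : Set} (p : Y → Bool) (f : X → List Y) xs →
                  count p (concatMap f xs) ≡ ℕList.sum (map (count p ∘ f) xs)
count-concatMap p f []       = refl
count-concatMap p f (x ∷ xs) =
  trans (count-++ p (f x) (concatMap f xs)) (cong (count p (f x) +_) (count-concatMap p f xs))

count-map : ∀ {X Y : Set} (p : Y → Bool) (f : X → Y) xs → count p (map f xs) ≡ count (p ∘ f) xs
count-map p f []       = refl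
count-map p f (x ∷ xs) = cong ((if p (f x) then 1 else 0) +_) (count-map p f xs)

count-cong : ∀ {X : Set} {p q : X → Bool} → (∀ x → p x ≡ q x) →
             ∀ xs → count p xs ≡ count q xs
count-cong p≗q []       = refl
count-cong p≗q (x ∷ xs) = cong₂ (λ b n → (if b then 1 else 0) + n) (p≗q x) (count-cong p≗q xs)

count-cong-All : ∀ {X : Set} {p q : X → Bool} {xs} →
                 All (λ x → p x ≡ q x) xs → count p xs ≡ count q xs
count-cong-All []            = refl
count-cong-All (px≡qx ∷ p≗q) =
  cong₂ (λ b n → (if b then 1 else 0) + n) px≡qx (count-cong-All p≗q)

count-false : ∀ {X : Set} {p : X → Bool} → (∀ x → p x ≡ false) → ∀ xs → count p xs ≡ 0
count-false p≗false xs = trans (count-cong p≗false xs) (count-const xs)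
  where
  count-const : ∀ xs → count (λ _ → false) xs ≡ 0
  count-const []       = refl
  count-const (x ∷ xs) = count-const xs

count-mono : ∀ {X : Set} {p q : X → Bool} → (∀ x → p x ≡ true → q x ≡ true) →
             ∀ xs → count p xs ≤ count q xs
count-mono p⇒q []       = z≤n
count-mono {p = p} {q} p⇒q (x ∷ xs) with p x in px | q x in qx
... | false | false = count-mono p⇒q xs
... | false | true  = m≤n⇒m≤1+n (count-mono p⇒q xs)
... | true  | true  = s≤s (count-mono p⇒q xs)
... | true  | false = contradiction (trans (sym (p⇒q x px)) qx) λ ()

isZero-+ : ∀ m n → isZero (m + n) ≡ isZero m ∧ isZero n
isZero-+ zero    n = refl
isZero-+ (suc m) n = refl

isZero-mono : ∀ {m n} → m ≤ n → isZero n ≡ true → isZero m ≡ true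
isZero-mono z≤n       _  = refl
isZero-mono (s≤s m≤n) ()

isZero-count : ∀ {X : Set} {p : X → Bool} xs →
               isZero (count p xs) ≡ true → All (λ x → p x ≡ false) xs
isZero-count []               _ = []
isZero-count {p = p} (x ∷ xs) h with p x in px
isZero-count (x ∷ xs) h  | false = px ∷ isZero-count xs h
isZero-count (x ∷ xs) () | true

pairs-map : ∀ {R S : ℕ → ℕ → Bool} (f : ℕ → ℕ) → (∀ y z → R (f y) (f z) ≡ S y z) →
            ∀ l → pairs R (map f l) ≡ pairs S l
pairs-map         f R∘f≗S []      = refl
pairs-map {R} {S} f R∘f≗S (y ∷ l) =
  cong₂ _+_ (trans (count-map (R (f y)) f l) (count-cong (R∘f≗S y) l)) (pairs-map f R∘f≗S l)

triples-map : ∀ {P Q : ℕ → ℕ → ℕ → Bool} (f : ℕ → ℕ) →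
              (∀ x y z → P (f x) (f y) (f z) ≡ Q x y z) → ∀ l → triples P (map f l) ≡ triples Q l
triples-map f P∘f≗Q []      = refl
triples-map f P∘f≗Q (x ∷ l) = cong₂ _+_ (pairs-map f (P∘f≗Q x) l) (triples-map f P∘f≗Q l)

pairs-mono : ∀ {R S : ℕ → ℕ → Bool} → (∀ y z → R y z ≡ true → S y z ≡ true) →
             ∀ l → pairs R l ≤ pairs S l
pairs-mono R⇒S []      = z≤n
pairs-mono R⇒S (y ∷ l) = +-mono-≤ (count-mono (R⇒S y) l) (pairs-mono R⇒S l)

distinct-cons : ∀ x l → distinct (x ∷ l) ≡ absent x l ∧ distinct l
distinct-cons x l = isZero-+ (count (x ≡ᵇ_) l) (pairs _≡ᵇ_ l)

increasingFrom-cons : ∀ t x l →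
                      increasingFrom t (x ∷ l) ≡ isZero (count (inversionFrom t x) l) ∧ increasingFrom t l
increasingFrom-cons t x l = isZero-+ (count (inversionFrom t x) l) (pairs (inversionFrom t) l)

avoids132-cons : ∀ x l → avoids132 (x ∷ l) ≡ increasingFrom (suc x) l ∧ avoids132 l
avoids132-cons x l = isZero-+ (pairs (pattern132 x) l) (triples pattern132 l)

word : ∀ {m n} → Vec (Fin m) n → List ℕ
word v = List.tabulate (λ i → toℕ (lookup v i))

∑-count : ∀ {n} p (f : Fin n → ℕ) →
          ∑[ k < n ] (if p (f k) then 1 else 0) ≡ count p (List.tabulate f)
∑-count {zero}  p f = refl
∑-count {suc n} p f = cong ((if p (f zero) then 1 else 0) +_) (∑-count p (f ∘ suc))

∑-pairs : ∀ {n} R (f : Fin n → ℕ) →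
          ∑[ j < n ] ∑[ k < n ] (if (toℕ j <ᵇ toℕ k) ∧ R (f j) (f k) then 1 else 0)
          ≡ pairs R (List.tabulate f)
∑-pairs {zero}  R f = refl
∑-pairs {suc n} R f = cong₂ _+_ (∑-count (R (f zero)) (f ∘ suc)) (∑-pairs R (f ∘ suc))

∑-triples : ∀ {n} P (f : Fin n → ℕ) →
            ∑[ i < n ] ∑[ j < n ] ∑[ k < n ]
              (if (toℕ i <ᵇ toℕ j) ∧ (toℕ j <ᵇ toℕ k) ∧ P (f i) (f j) (f k) then 1 else 0)
            ≡ triples P (List.tabulate f)
∑-triples {zero}  P f = refl
∑-triples {suc n} P f =
  cong₂ _+_ (cong₂ _+_ (sum-replicate-zero (suc n)) (∑-pairs (P (f zero)) (f ∘ suc)))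
            (trans (sum-cong-≗ {n} λ i → cong₂ _+_ (sum-replicate-zero (suc n)) (sum-cong-≗ {n} λ j →
                      cong₂ _+_ (cong (λ b → if b then 1 else 0) (∧-zeroʳ (toℕ i <ᵇ toℕ j))) refl))
                   (∑-triples P (f ∘ suc)))

sum-tabulate : ∀ {n} (f : Fin n → ℕ) → ℕList.sum (List.tabulate f) ≡ ∑[ i < n ] f i
sum-tabulate {zero}  f = refl
sum-tabulate {suc n} f = cong (f zero +_) (sum-tabulate (f ∘ suc))

sum-concatMap : ∀ {X : Set} (f : X → List ℕ) xs →
                ℕList.sum (concatMap f xs) ≡ ℕList.sum (map (ℕList.sum ∘ f) xs)
sum-concatMap f []       = refl
sum-concatMap f (x ∷ xs) =
  trans (sum-++ (f x) (concatMap f xs)) (cong (ℕList.sum (f x) +_) (sum-concatMap f xs))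

sum-map-allFin : ∀ {n} (f : Fin n → ℕ) → ℕList.sum (map f (allFin n)) ≡ ∑[ i < n ] f i
sum-map-allFin f = trans (cong ℕList.sum (map-tabulate (λ i → i) f)) (sum-tabulate f)

sum-concatMap-allFin : ∀ {n} (f : Fin n → List ℕ) →
                       ℕList.sum (concatMap f (allFin n)) ≡ ∑[ i < n ] ℕList.sum (f i)
sum-concatMap-allFin {n} f = trans (sum-concatMap f (allFin n)) (sum-map-allFin (ℕList.sum ∘ f))

sum-pairwise : ∀ {n} (g : Fin n → Fin n → ℕ) →
               ℕList.sum (concatMap (λ i → map (g i) (allFin n)) (allFin n))
               ≡ ∑[ i < n ] ∑[ j < n ] g i j
sum-pairwise {n} g =
  trans (sum-concatMap-allFin (λ i → map (g i) (allFin n))) (sum-cong-≗ {n} λ i → sum-map-allFin (g i))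

map-pairwise : ∀ {X Y : Set} {n} (f : X → Y) (g : Fin n → Fin n → X) →
               map f (concatMap (λ i → map (g i) (allFin n)) (allFin n))
               ≡ concatMap (λ i → map (f ∘ g i) (allFin n)) (allFin n)
map-pairwise {n = n} f g =
  trans (map-concatMap f _ (allFin n)) (concatMap-cong (λ i → sym (map-∘ (allFin n))) (allFin n))

countTriples≡triples : ∀ {n} P (v : Vec (Fin n) n) → countTriples P v ≡ triples P (word v)
countTriples≡triples {n} P v =
  trans (sum-concatMap-allFin (λ i → concatMap (λ j → map (occurs i j) (allFin n)) (allFin n)))
        (trans (sum-cong-≗ {n} λ i → sum-pairwise (occurs i)) (∑-triples P f))
  where
  f : Fin n → ℕ
  f i = toℕ (lookup v i)
  occurs : Fin n → Fin n → Fin n → ℕ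
  occurs i j k = if (toℕ i <ᵇ toℕ j) ∧ (toℕ j <ᵇ toℕ k) ∧ P (f i) (f j) (f k) then 1 else 0

and-map-not : ∀ bs → and (map not bs) ≡ isZero (ℕList.sum (map (λ b → if b then 1 else 0) bs))
and-map-not []           = refl
and-map-not (true  ∷ bs) = refl
and-map-not (false ∷ bs) = and-map-not bs

⌊≟⌋≡≡ᵇ : ∀ {n} (i j : Fin n) → ⌊ i ≟ j ⌋ ≡ (toℕ i ≡ᵇ toℕ j)
⌊≟⌋≡≡ᵇ zero    zero    = refl
⌊≟⌋≡≡ᵇ zero    (suc j) = refl
⌊≟⌋≡≡ᵇ (suc i) zero    = refl
⌊≟⌋≡≡ᵇ (suc i) (suc j) with i ≟ j | ⌊≟⌋≡≡ᵇ i j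
... | yes _ | eq = eq
... | no _  | eq = eq

-- The pairwise test inside isPerm uses a where-bound disjunction that cannot be
-- named here; unification against isPerm's unfolding recovers it.
isPerm-pairwise : ∀ {n} (v : Vec (Fin n) n) → Σ (Fin n → Fin n → Bool) λ F →
                  isPerm v ≡ and (concatMap (λ i → map (F i) (allFin n)) (allFin n))
isPerm-pairwise v = _ , refl

isPerm-test : ∀ {n} (v : Vec (Fin n) n) i j →
              proj₁ (isPerm-pairwise v) i j
              ≡ not ((toℕ i <ᵇ toℕ j) ∧ (toℕ (lookup v i) ≡ᵇ toℕ (lookup v j)))
isPerm-test v i j with toℕ i <ᵇ toℕ j
... | true  = cong not (⌊≟⌋≡≡ᵇ (lookup v i) (lookup v j))
... | false = refl

isPerm≡distinct : ∀ {n} (v : Vec (Fin n) n) → isPerm v ≡ distinct (word v)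
isPerm≡distinct {n} v = begin
  isPerm v
    ≡⟨ proj₂ (isPerm-pairwise v) ⟩
  and (concatMap (λ i → map (proj₁ (isPerm-pairwise v) i) (allFin n)) (allFin n))
    ≡⟨ cong and (concatMap-cong (λ i → map-cong (isPerm-test v i) (allFin n)) (allFin n)) ⟩
  and (concatMap (λ i → map (not ∘ equalPair i) (allFin n)) (allFin n))
    ≡⟨ cong and (map-pairwise not equalPair) ⟨
  and (map not equalPairs)
    ≡⟨ and-map-not equalPairs ⟩
  isZero (ℕList.sum (map (λ b → if b then 1 else 0) equalPairs))
    ≡⟨ cong isZero (trans (cong ℕList.sum (map-pairwise _ equalPair))
                          (sum-pairwise (λ i j → if equalPair i j then 1 else 0))) ⟩
  isZero (∑[ i < n ] ∑[ j < n ] (if equalPair i j then 1 else 0))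
    ≡⟨ cong isZero (∑-pairs _≡ᵇ_ (λ i → toℕ (lookup v i))) ⟩
  distinct (word v) ∎
  where
  open ≡-Reasoning
  equalPair : Fin n → Fin n → Bool
  equalPair i j = (toℕ i <ᵇ toℕ j) ∧ (toℕ (lookup v i) ≡ᵇ toℕ (lookup v j))
  equalPairs : List Bool
  equalPairs = concatMap (λ i → map (equalPair i) (allFin n)) (allFin n)

length-filter-filter : ∀ {X : Set} (p q : X → Bool) xs →
                       length (filter (λ x → q x Bool.≟ true) (filter (λ x → p x Bool.≟ true) xs))
                       ≡ count (λ x → p x ∧ q x) xs
length-filter-filter p q []       = refl
length-filter-filter p q (x ∷ xs) with p x
... | false = length-filter-filter p q xs
... | true with q x
...   | true  = cong suc (length-filter-filter p q xs)
...   | false = length-filter-filter p q xs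

isFour≡≡ᵇ4 : ∀ k → isFour k ≡ (k ≡ᵇ 4)
isFour≡≡ᵇ4 0 = refl
isFour≡≡ᵇ4 1 = refl
isFour≡≡ᵇ4 2 = refl
isFour≡≡ᵇ4 3 = refl
isFour≡≡ᵇ4 4 = refl
isFour≡≡ᵇ4 (suc (suc (suc (suc (suc k))))) = refl

<ᵇ-suc : ∀ x y → (x <ᵇ suc y) ≡ (x ≤ᵇ y)
<ᵇ-suc zero    y = refl
<ᵇ-suc (suc x) y = refl

≡ᵇ-refl : ∀ x → (x ≡ᵇ x) ≡ true
≡ᵇ-refl zero    = refl
≡ᵇ-refl (suc x) = ≡ᵇ-refl x

≤⇒≤ᵇ≡true : ∀ {t x} → t ≤ x → (t ≤ᵇ x) ≡ true
≤⇒≤ᵇ≡true                 z≤n       = refl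
≤⇒≤ᵇ≡true {suc t} {suc x} (s≤s t≤x) = trans (<ᵇ-suc t x) (≤⇒≤ᵇ≡true t≤x)

≤⇒<ᵇ≡false : ∀ {x t} → x ≤ t → (t <ᵇ x) ≡ false
≤⇒<ᵇ≡false z≤n       = refl
≤⇒<ᵇ≡false (s≤s x≤t) = ≤⇒<ᵇ≡false x≤t

<⇒≤ᵇ≡false : ∀ {j m} → j < m → (m ≤ᵇ j) ≡ false
<⇒≤ᵇ≡false (s≤s j≤m) = ≤⇒<ᵇ≡false j≤m

<⇒≡ᵇ≡false : ∀ {t x} → t < x → (t ≡ᵇ x) ≡ false
<⇒≡ᵇ≡false (s≤s z≤n)       = refl
<⇒≡ᵇ≡false (s≤s (s≤s t<x)) = <⇒≡ᵇ≡false (s≤s t<x)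

>⇒≡ᵇ≡false : ∀ {x t} → x < t → (t ≡ᵇ x) ≡ false
>⇒≡ᵇ≡false (s≤s z≤n)       = refl
>⇒≡ᵇ≡false (s≤s (s≤s x<t)) = >⇒≡ᵇ≡false (s≤s x<t)

<ᵇ-trichotomy : ∀ y w → (y ≡ᵇ w) ≡ false → (w <ᵇ y) ≡ false → (y <ᵇ w) ≡ true
<ᵇ-trichotomy zero    zero    () _
<ᵇ-trichotomy zero    (suc w) _  _  = refl
<ᵇ-trichotomy (suc y) zero    _  ()
<ᵇ-trichotomy (suc y) (suc w) y≢w w≮y = <ᵇ-trichotomy y w y≢w w≮y

∸-≤ᵇ-antitone : ∀ {n i k} → i ≤ n → k ≤ n → ((n ∸ i) ≤ᵇ (n ∸ k)) ≡ (k ≤ᵇ i)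
∸-≤ᵇ-antitone {zero}                z≤n       z≤n       = refl
∸-≤ᵇ-antitone {suc n} {zero}  {zero}  _         _         = ≤⇒≤ᵇ≡true (≤-refl {suc n})
∸-≤ᵇ-antitone {suc n} {zero}  {suc k} _         (s≤s k≤n) = <⇒≤ᵇ≡false (s≤s (m∸n≤m n k))
∸-≤ᵇ-antitone {suc n} {suc i} {zero}  (s≤s i≤n) _         =
  ≤⇒≤ᵇ≡true (≤-trans (m∸n≤m n i) (n≤1+n n))
∸-≤ᵇ-antitone {suc n} {suc i} {suc k} (s≤s i≤n) (s≤s k≤n) =
  trans (∸-≤ᵇ-antitone i≤n k≤n) (sym (<ᵇ-suc k i))

+-≡ᵇ : ∀ c a j → ((c + a) ≡ᵇ j) ≡ (c ≤ᵇ j) ∧ (a ≡ᵇ j ∸ c)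
+-≡ᵇ zero    a j       = refl
+-≡ᵇ (suc c) a zero    = refl
+-≡ᵇ (suc c) a (suc j) = trans (+-≡ᵇ c a j) (cong (_∧ (a ≡ᵇ j ∸ c)) (sym (<ᵇ-suc c j)))

∧-swap : ∀ a b c → a ∧ (b ∧ c) ≡ b ∧ (a ∧ c)
∧-swap true  b c = refl
∧-swap false b c = sym (∧-zeroʳ b)

-- punch x is the increasing bijection from ℕ onto ℕ ∖ {x}; on Fin it is punchIn.
punch : ℕ → ℕ → ℕ
punch zero    y       = suc y
punch (suc x) zero    = zero
punch (suc x) (suc y) = suc (punch x y)

toℕ-punchIn : ∀ {m} (x : Fin (suc m)) (y : Fin m) → toℕ (punchIn x y) ≡ punch (toℕ x) (toℕ y)
toℕ-punchIn zero    y       = refl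
toℕ-punchIn (suc x) zero    = refl
toℕ-punchIn (suc x) (suc y) = cong suc (toℕ-punchIn x y)

punch-skips : ∀ x y → (x ≡ᵇ punch x y) ≡ false
punch-skips zero    y       = refl
punch-skips (suc x) zero    = refl
punch-skips (suc x) (suc y) = punch-skips x y

punch-≡ᵇ : ∀ x y z → (punch x y ≡ᵇ punch x z) ≡ (y ≡ᵇ z)
punch-≡ᵇ zero    y       z       = refl
punch-≡ᵇ (suc x) zero    zero    = refl
punch-≡ᵇ (suc x) zero    (suc z) = refl
punch-≡ᵇ (suc x) (suc y) zero    = refl
punch-≡ᵇ (suc x) (suc y) (suc z) = punch-≡ᵇ x y z

punch-<ᵇ : ∀ x y z → (punch x y <ᵇ punch x z) ≡ (y <ᵇ z)
punch-<ᵇ zero    y       z       = refl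
punch-<ᵇ (suc x) zero    zero    = refl
punch-<ᵇ (suc x) zero    (suc z) = refl
punch-<ᵇ (suc x) (suc y) zero    = refl
punch-<ᵇ (suc x) (suc y) (suc z) = punch-<ᵇ x y z

punch-≤ᵇ-below : ∀ {t x} w → t ≤ x → (t ≤ᵇ punch x w) ≡ (t ≤ᵇ w)
punch-≤ᵇ-below                 w       z≤n       = refl
punch-≤ᵇ-below                 zero    (s≤s t≤x) = refl
punch-≤ᵇ-below {suc t} {suc x} (suc w) (s≤s t≤x) =
  trans (<ᵇ-suc t (punch x w)) (trans (punch-≤ᵇ-below w t≤x) (sym (<ᵇ-suc t w)))

punch-≤ᵇ-above : ∀ {x t} w → x ≤ t → (suc t ≤ᵇ punch x w) ≡ (t ≤ᵇ w)
punch-≤ᵇ-above {t = t}     w       z≤n       = <ᵇ-suc t w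
punch-≤ᵇ-above             zero    (s≤s x≤t) = refl
punch-≤ᵇ-above {t = suc t} (suc w) (s≤s x≤t) = trans (punch-≤ᵇ-above w x≤t) (sym (<ᵇ-suc t w))

punch-≡ᵇ-below : ∀ {t x} w → t < x → (t ≡ᵇ punch x w) ≡ (t ≡ᵇ w)
punch-≡ᵇ-below zero    (s≤s z≤n)       = refl
punch-≡ᵇ-below (suc w) (s≤s z≤n)       = refl
punch-≡ᵇ-below zero    (s≤s (s≤s t<x)) = refl
punch-≡ᵇ-below (suc w) (s≤s (s≤s t<x)) = punch-≡ᵇ-below w (s≤s t<x)

punch-≡ᵇ-above : ∀ {x t} w → x ≤ t → (suc t ≡ᵇ punch x w) ≡ (t ≡ᵇ w)
punch-≡ᵇ-above w       z≤n       = refl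
punch-≡ᵇ-above zero    (s≤s x≤t) = refl
punch-≡ᵇ-above (suc w) (s≤s x≤t) = punch-≡ᵇ-above w x≤t

distinct-punch : ∀ x u → distinct (map (punch x) u) ≡ distinct u
distinct-punch x u = cong isZero (pairs-map (punch x) (punch-≡ᵇ x) u)

absent-self : ∀ x l → absent x (x ∷ l) ≡ false
absent-self x l = cong (λ b → isZero ((if b then 1 else 0) + count (x ≡ᵇ_) l)) (≡ᵇ-refl x)

absent-punch : ∀ x y l → absent x (punch x y ∷ l) ≡ absent x l
absent-punch x y l = cong (λ b → isZero ((if b then 1 else 0) + count (x ≡ᵇ_) l)) (punch-skips x y)

countWords : (k m : ℕ) → (List ℕ → Bool) → ℕ
countWords k m p = count (p ∘ word) (allVecs k m)

countWords-cong : ∀ k m {p q : List ℕ → Bool} → (∀ l → p l ≡ q l) →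
                  countWords k m p ≡ countWords k m q
countWords-cong k m p≗q = count-cong (p≗q ∘ word) (allVecs k m)

countWords-suc : ∀ k m p → countWords (suc k) m p ≡ ∑[ x < m ] countWords k m (λ l → p (toℕ x ∷ l))
countWords-suc k m p = begin
  count (p ∘ word) (concatMap (λ x → map (x ∷_) (allVecs k m)) (allFin m))
    ≡⟨ count-concatMap (p ∘ word) _ (allFin m) ⟩
  ℕList.sum (map (λ x → count (p ∘ word) (map (x ∷_) (allVecs k m))) (allFin m))
    ≡⟨ sum-map-allFin (λ x → count (p ∘ word) (map (x ∷_) (allVecs k m))) ⟩
  ∑[ x < m ] count (p ∘ word) (map (x ∷_) (allVecs k m))
    ≡⟨ sum-cong-≗ {m} (λ x → count-map (p ∘ word) (x ∷_) (allVecs k m)) ⟩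
  ∑[ x < m ] countWords k m (λ l → p (toℕ x ∷ l)) ∎
  where open ≡-Reasoning

countWords-absent : ∀ k {m} (x : Fin (suc m)) p →
                    countWords k (suc m) (λ l → absent (toℕ x) l ∧ p l)
                    ≡ countWords k m (λ u → p (map (punch (toℕ x)) u))
countWords-absent zero        x p = refl
countWords-absent (suc k) {m} x p = begin
  countWords (suc k) (suc m) (λ l → absent x′ l ∧ p l)
    ≡⟨ countWords-suc k (suc m) (λ l → absent x′ l ∧ p l) ⟩
  ∑[ y < suc m ] countWords k (suc m) (q (toℕ y))
    ≡⟨ sum-remove {i = x} (λ y → countWords k (suc m) (q (toℕ y))) ⟩
  countWords k (suc m) (q x′) + ∑[ z < m ] countWords k (suc m) (q (toℕ (punchIn x z)))
    ≡⟨ cong₂ _+_ (count-false (λ v → cong (_∧ p (x′ ∷ word v)) (absent-self x′ (word v)))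
                              (allVecs k (suc m)))
                 (sum-cong-≗ {m} λ z → countWords-cong k (suc m) λ l →
                    cong (λ y → absent x′ (y ∷ l) ∧ p (y ∷ l)) (toℕ-punchIn x z)) ⟩
  ∑[ z < m ] countWords k (suc m) (q (punch x′ (toℕ z)))
    ≡⟨ sum-cong-≗ {m} (λ z → trans (countWords-cong k (suc m) λ l →
                                      cong (_∧ p (punch x′ (toℕ z) ∷ l)) (absent-punch x′ (toℕ z) l))
                                   (countWords-absent k x (λ l → p (punch x′ (toℕ z) ∷ l)))) ⟩
  ∑[ z < m ] countWords k m (λ u → p (map (punch x′) (toℕ z ∷ u)))
    ≡⟨ countWords-suc k m (λ u → p (map (punch x′) u)) ⟨
  countWords (suc k) m (λ u → p (map (punch x′) u)) ∎
  where
  open ≡-Reasoning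
  x′ : ℕ
  x′ = toℕ x
  q : ℕ → List ℕ → Bool
  q y l = absent x′ (y ∷ l) ∧ p (y ∷ l)

countPerms : ℕ → (List ℕ → Bool) → ℕ
countPerms n p = countWords n n (λ l → distinct l ∧ p l)

-- x ▹ u is the word with first letter x whose remaining letters standardise to u.
_▹_ : ℕ → List ℕ → List ℕ
x ▹ u = x ∷ map (punch x) u

countPerms-suc : ∀ n p → countPerms (suc n) p ≡ ∑[ x < suc n ] countPerms n (λ u → p (toℕ x ▹ u))
countPerms-suc n p = begin
  countPerms (suc n) p
    ≡⟨ countWords-suc n (suc n) (λ l → distinct l ∧ p l) ⟩
  ∑[ x < suc n ] countWords n (suc n) (λ l → distinct (toℕ x ∷ l) ∧ p (toℕ x ∷ l))
    ≡⟨ sum-cong-≗ {suc n} (λ x → countWords-cong n (suc n) λ l →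
         trans (cong (_∧ p (toℕ x ∷ l)) (distinct-cons (toℕ x) l)) (∧-assoc (absent (toℕ x) l) _ _)) ⟩
  ∑[ x < suc n ] countWords n (suc n) (λ l → absent (toℕ x) l ∧ (distinct l ∧ p (toℕ x ∷ l)))
    ≡⟨ sum-cong-≗ {suc n} (λ x → countWords-absent n x (λ l → distinct l ∧ p (toℕ x ∷ l))) ⟩
  ∑[ x < suc n ] countWords n n (λ u → distinct (map (punch (toℕ x)) u) ∧ p (toℕ x ▹ u))
    ≡⟨ sum-cong-≗ {suc n} (λ x → countWords-cong n n λ u →
         cong (_∧ p (toℕ x ▹ u)) (distinct-punch (toℕ x) u)) ⟩
  ∑[ x < suc n ] countPerms n (λ u → p (toℕ x ▹ u)) ∎
  where open ≡-Reasoning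

data IsPerm : ℕ → List ℕ → Set where
  []  : IsPerm zero []
  ins : ∀ {n u} (x : Fin (suc n)) → IsPerm n u → IsPerm (suc n) (toℕ x ▹ u)

countPerms-cong : ∀ n {p q : List ℕ → Bool} → (∀ {u} → IsPerm n u → p u ≡ q u) →
                  countPerms n p ≡ countPerms n q
countPerms-cong zero            p≗q = cong (λ b → (if b then 1 else 0) + 0) (p≗q [])
countPerms-cong (suc n) {p} {q} p≗q = begin
  countPerms (suc n) p
    ≡⟨ countPerms-suc n p ⟩
  ∑[ x < suc n ] countPerms n (λ u → p (toℕ x ▹ u))
    ≡⟨ sum-cong-≗ {suc n} (λ x → countPerms-cong n (p≗q ∘ ins x)) ⟩
  ∑[ x < suc n ] countPerms n (λ u → q (toℕ x ▹ u))
    ≡⟨ countPerms-suc n q ⟨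
  countPerms (suc n) q ∎
  where open ≡-Reasoning

countPerms-if : ∀ n b p → countPerms n (λ u → b ∧ p u) ≡ (if b then countPerms n p else 0)
countPerms-if n true  p = refl
countPerms-if n false p = count-false (λ v → ∧-zeroʳ (distinct (word v))) (allVecs n n)

IsPerm⇒distinct : ∀ {n u} → IsPerm n u → distinct u ≡ true
IsPerm⇒distinct []                 = refl
IsPerm⇒distinct (ins {u = u} x πu) =
  trans (distinct-cons (toℕ x) (map (punch (toℕ x)) u))
        (cong₂ _∧_ (cong isZero (trans (count-map (toℕ x ≡ᵇ_) (punch (toℕ x)) u)
                                       (count-false (punch-skips (toℕ x)) u)))
                   (trans (distinct-punch (toℕ x) u) (IsPerm⇒distinct πu)))

IsPerm-count-≥ : ∀ {n u} → IsPerm n u → ∀ t → count (t ≤ᵇ_) u ≡ n ∸ t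
IsPerm-count-≥ [] t = sym (0∸n≡0 t)
IsPerm-count-≥ {suc n} (ins {u = u} x πu) t with ≤-<-connex t (toℕ x)
... | inj₁ t≤x = begin
  (if t ≤ᵇ toℕ x then 1 else 0) + count (t ≤ᵇ_) (map (punch (toℕ x)) u)
    ≡⟨ cong₂ _+_ (cong (λ b → if b then 1 else 0) (≤⇒≤ᵇ≡true t≤x))
                 (trans (count-map _ _ u) (count-cong (λ w → punch-≤ᵇ-below w t≤x) u)) ⟩
  1 + count (t ≤ᵇ_) u ≡⟨ cong (1 +_) (IsPerm-count-≥ πu t) ⟩
  1 + (n ∸ t)         ≡⟨ +-∸-assoc 1 (≤-trans t≤x (toℕ≤pred[n] x)) ⟨
  suc n ∸ t           ∎
  where open ≡-Reasoning
... | inj₂ (s≤s {n = t′} x≤t′) = begin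
  (if t′ <ᵇ toℕ x then 1 else 0) + count (suc t′ ≤ᵇ_) (map (punch (toℕ x)) u)
    ≡⟨ cong₂ _+_ (cong (λ b → if b then 1 else 0) (≤⇒<ᵇ≡false x≤t′))
                 (trans (count-map _ _ u) (count-cong (λ w → punch-≤ᵇ-above w x≤t′) u)) ⟩
  count (t′ ≤ᵇ_) u ≡⟨ IsPerm-count-≥ πu t′ ⟩
  n ∸ t′           ∎
  where open ≡-Reasoning

IsPerm-count-≡ : ∀ {n u} → IsPerm n u → ∀ {t} → t < n → count (t ≡ᵇ_) u ≡ 1
IsPerm-count-≡ (ins {u = u} x πu) {t} t<n with <-cmp t (toℕ x)
... | tri< t<x _ _ =
  cong₂ _+_ (cong (λ b → if b then 1 else 0) (<⇒≡ᵇ≡false t<x))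
            (trans (trans (count-map _ _ u) (count-cong (λ w → punch-≡ᵇ-below w t<x) u))
                   (IsPerm-count-≡ πu (≤-trans t<x (toℕ≤pred[n] x))))
... | tri≈ _ refl _ =
  cong₂ _+_ (cong (λ b → if b then 1 else 0) (≡ᵇ-refl t))
            (trans (count-map _ _ u) (count-false (punch-skips t) u))
... | tri> _ _ x<t@(s≤s x≤t′) =
  cong₂ _+_ (cong (λ b → if b then 1 else 0) (>⇒≡ᵇ≡false x<t))
            (trans (trans (count-map _ _ u) (count-cong (λ w → punch-≡ᵇ-above w x≤t′) u))
                   (IsPerm-count-≡ πu (s≤s⁻¹ t<n)))

increasingFrom-mono : ∀ {s t} → s ≤ t → ∀ l →
                      increasingFrom s l ≡ true → increasingFrom t l ≡ true
increasingFrom-mono {s} {t} s≤t l = isZero-mono (pairs-mono weaken l)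
  where
  weaken : ∀ y z → inversionFrom t y z ≡ true → inversionFrom s y z ≡ true
  weaken y z inv = cong₂ _∧_ (≤⇒≤ᵇ≡true (≤-trans s≤t t≤z)) (∧-conicalʳ _ _ inv)
    where
    t≤z : t ≤ z
    t≤z = ≤ᵇ⇒≤ t z (Equivalence.from T-≡ (∧-conicalˡ _ _ inv))

increasingFrom-punch-below : ∀ {t x} → t ≤ x → ∀ u →
                             increasingFrom t (map (punch x) u) ≡ increasingFrom t u
increasingFrom-punch-below {x = x} t≤x u =
  cong isZero (pairs-map (punch x) (λ y z → cong₂ _∧_ (punch-≤ᵇ-below z t≤x) (punch-<ᵇ x z y)) u)

increasingFrom-punch-above : ∀ {x t} → x ≤ t → ∀ u →
                             increasingFrom (suc t) (map (punch x) u) ≡ increasingFrom t u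
increasingFrom-punch-above {x} x≤t u =
  cong isZero (pairs-map (punch x) (λ y z → cong₂ _∧_ (punch-≤ᵇ-above z x≤t) (punch-<ᵇ x z y)) u)

increasingFrom-bounded : ∀ {n l} → All (_< n) l → increasingFrom n l ≡ true
increasingFrom-bounded                 []        = refl
increasingFrom-bounded {n} {y ∷ l} (_ ∷ l<n) =
  trans (increasingFrom-cons n y l)
        (cong₂ _∧_ (cong isZero (trans (count-cong-All (All.map below l<n)) (count-false (λ _ → refl) l)))
                   (increasingFrom-bounded l<n))
  where
  below : ∀ {z} → z < n → inversionFrom n y z ≡ false
  below {z} (s≤s z≤n′) = cong (_∧ (z <ᵇ y)) (≤⇒<ᵇ≡false z≤n′)

inversionFrom-below : ∀ {x t} w → x ≤ t → inversionFrom t x w ≡ false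
inversionFrom-below {t = t}         w       z≤n       = ∧-zeroʳ (t ≤ᵇ w)
inversionFrom-below                 zero    (s≤s x≤t) = refl
inversionFrom-below {suc x} {suc t} (suc w) (s≤s x≤t) =
  trans (cong (_∧ (w <ᵇ x)) (<ᵇ-suc t w)) (inversionFrom-below w x≤t)

above-y⇔above-x : ∀ x y w → (x <ᵇ y) ≡ true → (y ≡ᵇ w) ≡ false →
                  (x <ᵇ w) ∧ (w <ᵇ y) ≡ false → (y <ᵇ w) ≡ (x <ᵇ w)
above-y⇔above-x x       zero    w       ()
above-y⇔above-x zero    (suc y) zero    _   _   _   = refl
above-y⇔above-x zero    (suc y) (suc w) _   y≢w w≮y = <ᵇ-trichotomy y w y≢w w≮y
above-y⇔above-x (suc x) (suc y) zero    _   _   _   = refl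
above-y⇔above-x (suc x) (suc y) (suc w) x<y y≢w h   = above-y⇔above-x x y w x<y y≢w h

C2-suc : ∀ m → suc m C 2 ≡ m + m C 2
C2-suc m = trans (sym (nCk+nC[k+1]≡[n+1]C[k+1] m 1)) (cong (_+ m C 2) (nC1≡n m))

pairs123-increasing : ∀ x l → distinct l ≡ true → increasingFrom (suc x) l ≡ true →
                      pairs (pattern123 x) l ≡ count (x <ᵇ_) l C 2
pairs123-increasing x []      _    _   = refl
pairs123-increasing x (y ∷ l) dist inc = split (x <ᵇ y) refl
  where
  open ≡-Reasoning
  y∉l : absent y l ≡ true
  y∉l = ∧-conicalˡ _ _ (trans (sym (distinct-cons y l)) dist)
  noInversion : isZero (count (inversionFrom (suc x) y) l) ≡ true
  noInversion = ∧-conicalˡ _ _ (trans (sym (increasingFrom-cons (suc x) y l)) inc)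
  IH : pairs (pattern123 x) l ≡ count (x <ᵇ_) l C 2
  IH = pairs123-increasing x l (∧-conicalʳ _ _ (trans (sym (distinct-cons y l)) dist))
                               (∧-conicalʳ _ _ (trans (sym (increasingFrom-cons (suc x) y l)) inc))

  split : ∀ b → (x <ᵇ y) ≡ b →
          count (λ w → b ∧ (y <ᵇ w)) l + pairs (pattern123 x) l ≡ ((if b then 1 else 0) + count (x <ᵇ_) l) C 2
  split false _   = trans (cong (_+ pairs (pattern123 x) l) (count-false (λ _ → refl) l)) IH
  split true  x<y = begin
    count (y <ᵇ_) l + pairs (pattern123 x) l
      ≡⟨ cong₂ _+_ (count-cong-All (All.zipWith above (isZero-count l y∉l , isZero-count l noInversion))) IH ⟩
    count (x <ᵇ_) l + count (x <ᵇ_) l C 2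
      ≡⟨ C2-suc (count (x <ᵇ_) l) ⟨
    suc (count (x <ᵇ_) l) C 2 ∎
    where
    above : ∀ {w} → (y ≡ᵇ w) ≡ false × inversionFrom (suc x) y w ≡ false → (y <ᵇ w) ≡ (x <ᵇ w)
    above {w} (y≢w , w∉xy) = above-y⇔above-x x y w x<y y≢w w∉xy

increasingFrom-▹-tail : ∀ {x t} → x ≤ t → ∀ u →
                        increasingFrom x u ≡ true → increasingFrom t (map (punch x) u) ≡ true
increasingFrom-▹-tail x≤t u inc with m≤n⇒m<n∨m≡n x≤t
... | inj₂ refl       = trans (increasingFrom-punch-below ≤-refl u) inc
... | inj₁ (s≤s x≤t′) = trans (increasingFrom-punch-above x≤t′ u) (increasingFrom-mono x≤t′ u inc)

-- The letter t occurs after the first letter x, and t ≤ t < x makes this an inversion from t.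
increasingFrom-▹-false : ∀ {n u} → IsPerm n u → ∀ {t x} → t < x → x ≤ n →
                         increasingFrom t (x ▹ u) ≡ false
increasingFrom-▹-false {n} {u} πu {t} {x} t<x x≤n =
  trans (increasingFrom-cons t x (map (punch x) u))
        (cong (_∧ increasingFrom t (map (punch x) u))
              (isZero-positive (≤-trans (≤-reflexive (sym t-once)) t-below)))
  where
  isZero-positive : ∀ {c} → 1 ≤ c → isZero c ≡ false
  isZero-positive (s≤s _) = refl
  t-once : count (t ≡ᵇ_) (map (punch x) u) ≡ 1
  t-once = trans (count-map _ _ u)
                 (trans (count-cong (λ w → punch-≡ᵇ-below w t<x) u) (IsPerm-count-≡ πu (≤-trans t<x x≤n)))
  t-below : count (t ≡ᵇ_) (map (punch x) u) ≤ count (inversionFrom t x) (map (punch x) u)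
  t-below = count-mono (λ w t≡w → subst (λ w → inversionFrom t x w ≡ true)
                                         (≡ᵇ⇒≡ t w (Equivalence.from T-≡ t≡w))
                                         (cong₂ _∧_ (≤⇒≤ᵇ≡true (≤-refl {t})) (≤⇒≤ᵇ≡true t<x)))
                       (map (punch x) u)

avoider : ℕ → ℕ → List ℕ → Bool
avoider t j l = increasingFrom t l ∧ avoids132 l ∧ (triples pattern123 l ≡ᵇ j)

avoiders : ℕ → ℕ → ℕ → ℕ
avoiders n t j = countPerms n (avoider t j)

avoider-▹ : ∀ {n u} → IsPerm n u → ∀ {x} → x ≤ n → ∀ t j →
            avoider t j (x ▹ u) ≡ ((x ≤ᵇ t) ∧ ((n ∸ x) C 2 ≤ᵇ j)) ∧ avoider x (j ∸ (n ∸ x) C 2) u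
avoider-▹ {n} {u} πu {x} x≤n t j with ≤-<-connex x t
... | inj₂ t<x@(s≤s t≤x′) =
  trans (cong (_∧ (avoids132 (x ▹ u) ∧ (triples pattern123 (x ▹ u) ≡ᵇ j)))
              (increasingFrom-▹-false πu t<x x≤n))
        (cong (λ b → (b ∧ ((n ∸ x) C 2 ≤ᵇ j)) ∧ avoider x (j ∸ (n ∸ x) C 2) u)
              (sym (≤⇒<ᵇ≡false t≤x′)))
... | inj₁ x≤t = begin
  avoider t j (x ▹ u)
    ≡⟨ cong₂ _∧_ head-free
                 (cong₂ _∧_ avoids132-▹ (cong (λ s → (pairs (pattern123 x) u′ + s) ≡ᵇ j) 123-punch)) ⟩
  increasingFrom t u′ ∧ ((inc ∧ av) ∧ ((pairs (pattern123 x) u′ + n₁₂₃) ≡ᵇ j))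
    ≡⟨ split inc refl ⟩
  ((x ≤ᵇ t) ∧ (c ≤ᵇ j)) ∧ avoider x (j ∸ c) u ∎
  where
  open ≡-Reasoning
  u′ : List ℕ
  u′ = map (punch x) u
  inc av : Bool
  inc = increasingFrom x u
  av  = avoids132 u
  n₁₂₃ c : ℕ
  n₁₂₃ = triples pattern123 u
  c    = (n ∸ x) C 2

  head-free : increasingFrom t (x ∷ u′) ≡ increasingFrom t u′
  head-free = trans (increasingFrom-cons t x u′)
                    (cong (λ c → isZero c ∧ increasingFrom t u′)
                          (count-false (λ w → inversionFrom-below w x≤t) u′))

  avoids132-▹ : avoids132 (x ∷ u′) ≡ inc ∧ av
  avoids132-▹ = trans (avoids132-cons x u′)
    (cong₂ _∧_ (increasingFrom-punch-above ≤-refl u)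
               (cong isZero (triples-map (punch x)
                                         (λ a b c → cong₂ _∧_ (punch-<ᵇ x a c) (punch-<ᵇ x c b)) u)))

  123-punch : triples pattern123 u′ ≡ n₁₂₃
  123-punch = triples-map (punch x) (λ a b c → cong₂ _∧_ (punch-<ᵇ x a b) (punch-<ᵇ x b c)) u

  123-from-x : inc ≡ true → pairs (pattern123 x) u′ ≡ c
  123-from-x inc≡true = begin
    pairs (pattern123 x) u′
      ≡⟨ pairs123-increasing x u′ (trans (distinct-punch x u) (IsPerm⇒distinct πu))
                                   (trans (increasingFrom-punch-above ≤-refl u) inc≡true) ⟩
    count (x <ᵇ_) u′ C 2
      ≡⟨ cong (_C 2) (trans (count-map (x <ᵇ_) (punch x) u)
                            (count-cong (λ w → punch-≤ᵇ-above {x} w ≤-refl) u)) ⟩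
    count (x ≤ᵇ_) u C 2
      ≡⟨ cong (_C 2) (IsPerm-count-≥ πu x) ⟩
    c ∎

  split : ∀ b → inc ≡ b →
          increasingFrom t u′ ∧ ((b ∧ av) ∧ ((pairs (pattern123 x) u′ + n₁₂₃) ≡ᵇ j))
          ≡ ((x ≤ᵇ t) ∧ (c ≤ᵇ j)) ∧ (b ∧ (av ∧ (n₁₂₃ ≡ᵇ j ∸ c)))
  split false _        = trans (∧-zeroʳ (increasingFrom t u′)) (sym (∧-zeroʳ _))
  split true  inc≡true = begin
    increasingFrom t u′ ∧ (av ∧ ((pairs (pattern123 x) u′ + n₁₂₃) ≡ᵇ j))
      ≡⟨ cong₂ (λ b p → b ∧ (av ∧ ((p + n₁₂₃) ≡ᵇ j)))
               (increasingFrom-▹-tail x≤t u inc≡true) (123-from-x inc≡true) ⟩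
    av ∧ ((c + n₁₂₃) ≡ᵇ j)
      ≡⟨ cong (av ∧_) (+-≡ᵇ c n₁₂₃ j) ⟩
    av ∧ ((c ≤ᵇ j) ∧ (n₁₂₃ ≡ᵇ j ∸ c))
      ≡⟨ ∧-swap av (c ≤ᵇ j) (n₁₂₃ ≡ᵇ j ∸ c) ⟩
    (c ≤ᵇ j) ∧ (av ∧ (n₁₂₃ ≡ᵇ j ∸ c))
      ≡⟨ cong (λ b → (b ∧ (c ≤ᵇ j)) ∧ (av ∧ (n₁₂₃ ≡ᵇ j ∸ c)))
              (≤⇒≤ᵇ≡true x≤t) ⟨
    ((x ≤ᵇ t) ∧ (c ≤ᵇ j)) ∧ (av ∧ (n₁₂₃ ≡ᵇ j ∸ c)) ∎

firstLetter : ℕ → ℕ → ℕ → ℕ → ℕ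
firstLetter n t j x = if (x ≤ᵇ t) ∧ ((n ∸ x) C 2 ≤ᵇ j) then avoiders n x (j ∸ (n ∸ x) C 2) else 0

avoiders-suc : ∀ n t j → avoiders (suc n) t j ≡ ∑[ x < suc n ] firstLetter n t j (toℕ x)
avoiders-suc n t j =
  trans (countPerms-suc n (avoider t j))
        (sum-cong-≗ {suc n} λ x → trans (countPerms-cong n (λ πu → avoider-▹ πu (toℕ≤pred[n] x) t j))
                                        (countPerms-if n ((toℕ x ≤ᵇ t) ∧ ((n ∸ toℕ x) C 2 ≤ᵇ j))
                                                         (avoider (toℕ x) (j ∸ (n ∸ toℕ x) C 2))))

a≡avoiders : ∀ n → a n ≡ avoiders n n 4
a≡avoiders n =
  trans (length-filter-filter isPerm (λ π → isZero (#132 π) ∧ isFour (#123 π)) (allVecs n n))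
        (count-cong (λ v → cong₂ _∧_ (isPerm≡distinct v) (counted≡avoider v)) (allVecs n n))
  where
  counted≡avoider : ∀ v → isZero (#132 v) ∧ isFour (#123 v) ≡ avoider n 4 (word v)
  counted≡avoider v = begin
    isZero (#132 v) ∧ isFour (#123 v)
      ≡⟨ cong₂ _∧_ (cong isZero (countTriples≡triples pattern132 v))
                   (trans (isFour≡≡ᵇ4 (#123 v)) (cong (_≡ᵇ 4) (countTriples≡triples pattern123 v))) ⟩
    avoids132 (word v) ∧ (triples pattern123 (word v) ≡ᵇ 4)
      ≡⟨ cong (_∧ (avoids132 (word v) ∧ (triples pattern123 (word v) ≡ᵇ 4)))
              (increasingFrom-bounded (tabulate⁺ (λ i → toℕ<n (lookup v i)))) ⟨
    avoider n 4 (word v) ∎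
    where open ≡-Reasoning

-- Zero for k > n, so that avoidersTop-suc holds from n = 0 on.
avoidersTop : ℕ → ℕ → ℕ → ℕ
avoidersTop n k j = if k ≤ᵇ n then avoiders n (n ∸ k) j else 0

-- A first letter with i larger letters keeps the k largest letters increasing iff k ≤ i + 1,
-- and it starts C(i,2) copies of 123.
fits : ℕ → ℕ → ℕ → Bool
fits k j i = (k ≤ᵇ suc i) ∧ (i C 2 ≤ᵇ j)

transfer : ℕ → ℕ → ℕ → ℕ → ℕ
transfer n k j i = if fits k j i then avoidersTop n i (j ∸ i C 2) else 0

if-zero : ∀ b {x} → x ≡ 0 → (if b then x else 0) ≡ 0
if-zero true  x≡0 = x≡0
if-zero false _   = refl

C2≥6 : ∀ {i} → 4 ≤ i → 6 ≤ i C 2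
C2≥6 {4}     _         = ≤-refl
C2≥6 {suc i} (s≤s 3≤i) with m≤n⇒m<n∨m≡n 3≤i
... | inj₂ refl = ≤-refl
... | inj₁ 4≤i  = ≤-trans (C2≥6 4≤i) (≤-trans (m≤n+m (i C 2) i) (≤-reflexive (sym (C2-suc i))))

transfer-beyond-n : ∀ {n i} k j → n < i → transfer n k j i ≡ 0
transfer-beyond-n {n} {i} k j n<i =
  if-zero (fits k j i) (cong (λ b → if b then avoiders n (n ∸ i) (j ∸ i C 2) else 0)
                             (<⇒≤ᵇ≡false n<i))

transfer-beyond-3 : ∀ n k {j i} → j < 5 → 4 ≤ i → transfer n k j i ≡ 0
transfer-beyond-3 n k {j} {i} j<5 4≤i =
  cong (λ b → if b then avoidersTop n i (j ∸ i C 2) else 0)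
       (trans (cong ((k ≤ᵇ suc i) ∧_) (<⇒≤ᵇ≡false (≤-trans j<5 (≤-trans (n≤1+n 5) (C2≥6 4≤i)))))
              (∧-zeroʳ (k ≤ᵇ suc i)))

transfer-too-high : ∀ {n k} j i → suc n < k → transfer n k j i ≡ 0
transfer-too-high {n} {k} j i n+1<k with ≤-<-connex i n
... | inj₁ i≤n = cong (λ b → if b ∧ (i C 2 ≤ᵇ j) then avoidersTop n i (j ∸ i C 2) else 0)
                      (<⇒≤ᵇ≡false (≤-trans (s≤s (s≤s i≤n)) n+1<k))
... | inj₂ n<i = transfer-beyond-n k j n<i

firstLetter-reverse : ∀ {n k} j {i} → k ≤ suc n → i ≤ n →
                      firstLetter n (suc n ∸ k) j (n ∸ i) ≡ transfer n k j i
firstLetter-reverse {n} {k} j {i} k≤n+1 i≤n = begin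
  firstLetter n (suc n ∸ k) j (n ∸ i)
    ≡⟨ cong (λ e → if (n ∸ i ≤ᵇ suc n ∸ k) ∧ (e C 2 ≤ᵇ j)
                   then avoiders n (n ∸ i) (j ∸ e C 2) else 0)
            (m∸[m∸n]≡n i≤n) ⟩
  (if (n ∸ i ≤ᵇ suc n ∸ k) ∧ (i C 2 ≤ᵇ j) then avoiders n (n ∸ i) (j ∸ i C 2) else 0)
    ≡⟨ cong₂ (λ b y → if b ∧ (i C 2 ≤ᵇ j) then y else 0)
             (∸-≤ᵇ-antitone (s≤s i≤n) k≤n+1)
             (cong (λ b → if b then avoiders n (n ∸ i) (j ∸ i C 2) else 0) (sym (≤⇒≤ᵇ≡true i≤n))) ⟩
  transfer n k j i ∎
  where open ≡-Reasoning

∑-reverse : ∀ {m} (f : ℕ → ℕ) → ∑[ x < suc m ] f (toℕ x) ≡ ∑[ i < suc m ] f (m ∸ toℕ i)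
∑-reverse {m} f =
  trans (∑-permute (f ∘ toℕ) Permutation.reverse) (sum-cong-≗ {suc m} λ i → cong f (opposite-prop i))

∑-truncate : ∀ {a b} (h : ℕ → ℕ) → (∀ i → a ≤ i → h i ≡ 0) → (∀ i → b ≤ i → h i ≡ 0) →
             ∑[ i < a ] h (toℕ i) ≡ ∑[ i < b ] h (toℕ i)
∑-truncate {zero}  {zero}  h _   _   = refl
∑-truncate {zero}  {suc b} h h≡0 _   =
  sym (trans (sum-cong-≗ {suc b} λ i → h≡0 (toℕ i) z≤n) (sum-replicate-zero (suc b)))
∑-truncate {suc a} {zero}  h _   h≡0 =
  trans (sum-cong-≗ {suc a} λ i → h≡0 (toℕ i) z≤n) (sum-replicate-zero (suc a))
∑-truncate {suc a} {suc b} h ha  hb  =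
  cong (h 0 +_) (∑-truncate (h ∘ suc) (λ i a≤i → ha (suc i) (s≤s a≤i))
                                     (λ i b≤i → hb (suc i) (s≤s b≤i)))

avoidersTop-suc : ∀ n k {j} → j < 5 → avoidersTop (suc n) k j ≡ ∑[ i < 4 ] transfer n k j (toℕ i)
avoidersTop-suc n k {j} j<5 with ≤-<-connex k (suc n)
... | inj₁ k≤n+1 = begin
  avoidersTop (suc n) k j
    ≡⟨ cong (λ b → if b then avoiders (suc n) (suc n ∸ k) j else 0) (≤⇒≤ᵇ≡true k≤n+1) ⟩
  avoiders (suc n) (suc n ∸ k) j
    ≡⟨ avoiders-suc n (suc n ∸ k) j ⟩
  ∑[ x < suc n ] firstLetter n (suc n ∸ k) j (toℕ x)
    ≡⟨ ∑-reverse {n} (firstLetter n (suc n ∸ k) j) ⟩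
  ∑[ i < suc n ] firstLetter n (suc n ∸ k) j (n ∸ toℕ i)
    ≡⟨ sum-cong-≗ {suc n} (λ i → firstLetter-reverse j k≤n+1 (toℕ≤pred[n] i)) ⟩
  ∑[ i < suc n ] transfer n k j (toℕ i)
    ≡⟨ ∑-truncate {suc n} {4} (transfer n k j) (λ _ → transfer-beyond-n k j)
                                              (λ _ → transfer-beyond-3 n k j<5) ⟩
  ∑[ i < 4 ] transfer n k j (toℕ i) ∎
  where open ≡-Reasoning
... | inj₂ n+1<k =
  trans (cong (λ b → if b then avoiders (suc n) (suc n ∸ k) j else 0) (<⇒≤ᵇ≡false n+1<k))
        (∑-truncate {0} {4} (transfer n k j) (λ i _ → transfer-too-high j i n+1<k)
                                             (λ i _ → transfer-too-high j i n+1<k))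

Table : Set
Table = ℕ → ℕ → ℤ

-- Definitionally equal to ℤΣ.sum {4} (λ i → term (toℕ i)), but written out: evaluating
-- table through the algebra bundle's projections is markedly slower.
step : Table → Table
step f k j = term 0 ℤ.+ (term 1 ℤ.+ (term 2 ℤ.+ (term 3 ℤ.+ 0ℤ)))
  where
  term : ℕ → ℤ
  term i = if fits k j i then f i (j ∸ i C 2) else 0ℤ

empty : Table
empty zero zero = 1ℤ
empty _    _    = 0ℤ

table : ℕ → Table
table zero    = empty
table (suc n) = step (table n)

pos-∑ : ∀ {n} (f : Fin n → ℕ) → pos (∑[ i < n ] f i) ≡ ℤΣ.sum (λ i → pos (f i))
pos-∑ {zero}  f = refl
pos-∑ {suc n} f =
  trans (ℤ.pos-+ (f zero) (∑[ i < n ] f (suc i))) (cong (ℤ._+_ (pos (f zero))) (pos-∑ (f ∘ suc)))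

table≡avoidersTop : ∀ n k {j} → j < 5 → table n k j ≡ pos (avoidersTop n k j)
table≡avoidersTop zero    zero    {zero}  _   = refl
table≡avoidersTop zero    zero    {suc j} _   = refl
table≡avoidersTop zero    (suc k)         _   = refl
table≡avoidersTop (suc n) k       {j}     j<5 = begin
  ℤΣ.sum {4} (λ i → if fits k j (toℕ i) then table n (toℕ i) (j ∸ toℕ i C 2) else 0ℤ)
    ≡⟨ ℤΣ.sum-cong-≗ {4} (λ i → trans (cong (λ x → if fits k j (toℕ i) then x else 0ℤ) (IH i))
                                      (sym (if-float pos (fits k j (toℕ i))))) ⟩
  ℤΣ.sum {4} (λ i → pos (transfer n k j (toℕ i)))
    ≡⟨ pos-∑ {4} (transfer n k j ∘ toℕ) ⟨
  pos (∑[ i < 4 ] transfer n k j (toℕ i))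
    ≡⟨ cong pos (avoidersTop-suc n k j<5) ⟨
  pos (avoidersTop (suc n) k j) ∎
  where
  open ≡-Reasoning
  IH : ∀ (i : Fin 4) → table n (toℕ i) (j ∸ toℕ i C 2) ≡ pos (avoidersTop n (toℕ i) (j ∸ toℕ i C 2))
  IH i = table≡avoidersTop n (toℕ i) (≤-<-trans (m∸n≤m j (toℕ i C 2)) j<5)

step-linear : ∀ c f g k j →
              step (λ k j → c ℤ.* f k j ℤ.+ g k j) k j ≡ c ℤ.* step f k j ℤ.+ step g k j
step-linear c f g k j = begin
  ℤΣ.sum {4} (λ i → if b i then c ℤ.* f′ i ℤ.+ g′ i else 0ℤ)
    ≡⟨ ℤΣ.sum-cong-≗ {4} (λ i → if-linear (b i) {f′ i} {g′ i}) ⟩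
  ℤΣ.sum {4} (λ i → c ℤ.* (if b i then f′ i else 0ℤ) ℤ.+ (if b i then g′ i else 0ℤ))
    ≡⟨ ℤΣ.∑-distrib-+ (λ i → c ℤ.* (if b i then f′ i else 0ℤ))
                      (λ i → if b i then g′ i else 0ℤ) ⟩
  ℤΣ.sum (λ i → c ℤ.* (if b i then f′ i else 0ℤ)) ℤ.+ step g k j
    ≡⟨ cong (ℤ._+ step g k j) (ℤΣ.*-distribˡ-sum c (λ i → if b i then f′ i else 0ℤ)) ⟨
  c ℤ.* step f k j ℤ.+ step g k j ∎
  where
  open ≡-Reasoning
  b : Fin 4 → Bool
  b i = fits k j (toℕ i)
  f′ g′ : Fin 4 → ℤ
  f′ i = f (toℕ i) (j ∸ toℕ i C 2)
  g′ i = g (toℕ i) (j ∸ toℕ i C 2)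
  if-linear : ∀ b {x y} →
              (if b then c ℤ.* x ℤ.+ y else 0ℤ) ≡ c ℤ.* (if b then x else 0ℤ) ℤ.+ (if b then y else 0ℤ)
  if-linear true  = refl
  if-linear false = sym (trans (ℤ.+-identityʳ (c ℤ.* 0ℤ)) (ℤ.*-zeroʳ c))

step-zero : ∀ k j → step (λ _ _ → 0ℤ) k j ≡ 0ℤ
step-zero k j = trans (ℤΣ.sum-cong-≗ {4} (λ i → if-0ℤ (fits k j (toℕ i)))) (ℤΣ.sum-replicate-zero 4)
  where
  if-0ℤ : ∀ b → (if b then 0ℤ else 0ℤ) ≡ 0ℤ
  if-0ℤ true  = refl
  if-0ℤ false = refl

step-local : ∀ {f g} k j → (∀ i j′ → i < 4 → j′ ≤ j → f i j′ ≡ g i j′) →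
             step f k j ≡ step g k j
step-local k j f≗g = ℤΣ.sum-cong-≗ {4} λ i →
  cong (λ x → if fits k j (toℕ i) then x else 0ℤ)
       (f≗g (toℕ i) (j ∸ toℕ i C 2) (toℕ<n i) (m∸n≤m j (toℕ i C 2)))

module _ (L : Table → Table)
         (L-linear : ∀ c f g k j →
                     L (λ k j → c ℤ.* f k j ℤ.+ g k j) k j ≡ c ℤ.* L f k j ℤ.+ L g k j)
         (L-zero : ∀ k j → L (λ _ _ → 0ℤ) k j ≡ 0ℤ) where

  seriesTimesPoly-recurrence :
    ∀ (X : ℕ → Table) → (∀ m k j → X (suc m) k j ≡ L (X m) k j) →
    ∀ p {n} → List.length p ≤ n → ∀ k j →
    seriesTimesPoly (λ m → X m k j) p (suc n) ≡ L (λ k j → seriesTimesPoly (λ m → X m k j) p n) k j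
  seriesTimesPoly-recurrence X X-rec []      _ k j = sym (L-zero k j)
  seriesTimesPoly-recurrence X X-rec (c ∷ p) {suc n} (s≤s len≤n) k j = begin
    c ℤ.* X (suc (suc n)) k j ℤ.+ seriesTimesPoly (λ m → X m k j) p (suc n)
      ≡⟨ cong₂ (λ x y → c ℤ.* x ℤ.+ y) (X-rec (suc n) k j)
               (seriesTimesPoly-recurrence X X-rec p len≤n k j) ⟩
    c ℤ.* L (X (suc n)) k j ℤ.+ L (λ k j → seriesTimesPoly (λ m → X m k j) p n) k j
      ≡⟨ L-linear c (X (suc n)) (λ k j → seriesTimesPoly (λ m → X m k j) p n) k j ⟨
    L (λ k j → c ℤ.* X (suc n) k j ℤ.+ seriesTimesPoly (λ m → X m k j) p n) k j ∎
    where open ≡-Reasoning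

seriesTimesPoly-cong : ∀ {f g : ℕ → ℤ} → (∀ m → f m ≡ g m) →
                       ∀ p n → seriesTimesPoly f p n ≡ seriesTimesPoly g p n
seriesTimesPoly-cong f≗g []      n       = refl
seriesTimesPoly-cong f≗g (c ∷ p) zero    = cong (ℤ._*_ c) (f≗g 0)
seriesTimesPoly-cong f≗g (c ∷ p) (suc n) =
  cong₂ (λ x y → c ℤ.* x ℤ.+ y) (f≗g (suc n)) (seriesTimesPoly-cong f≗g p n)

pcoeff-beyond : ∀ p {n} → List.length p ≤ n → pcoeff p n ≡ 0ℤ
pcoeff-beyond []      _           = refl
pcoeff-beyond (c ∷ p) (s≤s len≤n) = pcoeff-beyond p len≤n

∀Fin⇒∀< : ∀ {n} {P : ℕ → Set} → (∀ (i : Fin n) → P (toℕ i)) → ∀ {m} → m < n → P m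
∀Fin⇒∀< {P = P} P-Fin m<n = subst P (toℕ-fromℕ< m<n) (P-Fin (fromℕ< m<n))

tableTimesDenom : ℕ → Table
tableTimesDenom n k j = seriesTimesPoly (λ m → table m k j) denom n

tableTimesDenom-suc : ∀ {n} → 6 ≤ n → ∀ k j →
                      tableTimesDenom (suc n) k j ≡ step (tableTimesDenom n) k j
tableTimesDenom-suc = seriesTimesPoly-recurrence step step-linear step-zero table (λ _ _ _ → refl) denom

tableTimesDenom-11 : ∀ (k : Fin 4) (j : Fin 5) → tableTimesDenom 11 (toℕ k) (toℕ j) ≡ 0ℤ
tableTimesDenom-11 =
  toWitness {a? = all? λ k → all? λ j → tableTimesDenom 11 (toℕ k) (toℕ j) ℤ.≟ 0ℤ} _

tableTimesDenom-vanishes : ∀ {n} → 11 ≤′ n → ∀ {k j} → k < 4 → j < 5 →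
                           tableTimesDenom n k j ≡ 0ℤ
tableTimesDenom-vanishes ≤′-refl k<4 j<5 = ∀Fin⇒∀< (λ k → ∀Fin⇒∀< (tableTimesDenom-11 k) j<5) k<4
tableTimesDenom-vanishes {suc n} (≤′-step 11≤n) {k} {j} k<4 j<5 =
  trans (tableTimesDenom-suc (≤-trans (m≤m+n 6 5) (≤′⇒≤ 11≤n)) k j)
        (trans (step-local k j λ i j′ i<4 j′≤j →
                  tableTimesDenom-vanishes 11≤n i<4 (≤-<-trans j′≤j j<5))
               (step-zero k j))

tableTimesDenom-small : ∀ (n : Fin 11) → tableTimesDenom (toℕ n) 0 4 ≡ pcoeff numer (toℕ n)
tableTimesDenom-small =
  toWitness {a? = all? λ n → tableTimesDenom (toℕ n) 0 4 ℤ.≟ pcoeff numer (toℕ n)} _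

A≡table : ∀ m → A m ≡ table m 0 4
A≡table m = trans (cong pos (a≡avoiders m)) (sym (table≡avoidersTop m 0 (n<1+n 4)))

mainTheorem5 : (n : ℕ) → seriesTimesPoly A denom n ≡ pcoeff numer n
mainTheorem5 n = trans (seriesTimesPoly-cong A≡table denom n) (coefficient n)
  where
  coefficient : ∀ n → tableTimesDenom n 0 4 ≡ pcoeff numer n
  coefficient n with n <? 11
  ... | yes n<11 = ∀Fin⇒∀< tableTimesDenom-small n<11
  ... | no  n≮11 = trans (tableTimesDenom-vanishes (≤⇒≤′ (≮⇒≥ n≮11)) z<s (n<1+n 4))
                         (sym (pcoeff-beyond numer (≤-trans (n≤1+n 10) (≮⇒≥ n≮11))))
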